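{- Let $G=(V,E)$ be a finite connected undirected multigraph without self-loops. Let $P=\{V_1,\dots,V_{k_P}\}$ be a feasible partition of $V$, let $G_i=(V_i,E_i)$ be the subgraph induced by $V_i$ for $i=1,\dots,k_P$, and let $\Gamma^P$ be the set of spanning trees $\gamma$ of $G$ such that $\gamma\cap E_P$ is a spanning tree of the shrunk graph $G_P$. Then: (i) $\psi_{E_P}(\Gamma^P)=\Gamma_{G_P}$ and $\psi_{E_i}(\Gamma^P)=\Gamma_{G_i}$ for all $i=1,\dots,k_P$; (ii) $\Gamma^P=\psi_{E_1}(\Gamma^P)\oplus\cdots\oplus\psi_{E_{k_P}}(\Gamma^P)\oplus\psi_{E_P}(\Gamma^P)=\Gamma_{G_1}\oplus\cdots\oplus\Gamma_{G_{k_P}}\oplus\Gamma_{G_P}$.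
   Context: A feasible partition of $V$ is a partition $P=\{V_1,\dots,V_{k_P}\}$ with $k_P\ge2$ such that each induced subgraph $G(V_i)$ is connected; $E_P$ is the set of edges joining different parts; the shrunk graph $G_P$ is obtained by identifying each $V_i$ to one vertex and deleting self-loops (its edge set is identified with $E_P$). For a graph $H$, $\Gamma_H$ denotes its set of spanning trees, viewed as edge sets. For $A\subset E$, $\psi_A(\gamma)=\gamma\cap A$ and $\psi_A(\mathcal{F})=\{\gamma\cap A:\gamma\in\mathcal{F}\}$. For families $\Gamma_1,\dots,\Gamma_m$ of subsets of pairwise disjoint edge sets, $\Gamma_1\oplus\cdots\oplus\Gamma_m=\{\bigcup_{j}\gamma_j:\gamma_j\in\Gamma_j\}$. -}

module Defs where

open import Data.Nat using (ℕ; _≤_)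
open import Data.Fin using (Fin; _≟_)
open import Data.Fin.Subset using (Subset; _∈_; _⊆_; _∩_; _∪_; ∁; ⁅_⁆; ⋃; ⊤)
open import Data.Bool using (Bool; _∧_; not)
open import Data.Vec using (tabulate)
open import Data.List using (List)
import Data.List as List
open import Data.Product using (Σ; _×_; _,_; proj₁; proj₂; ∃)
open import Relation.Nullary using (¬_)
open import Relation.Nullary.Decidable using (⌊_⌋)
open import Relation.Binary.PropositionalEquality using (_≡_; _≢_)
open import Function.Bundles using (_⇔_)

-- A finite multigraph: vertices Fin n, edges Fin m, each edge e has
-- endpoints ends e = (u , v).  Parallel edges are allowed.
Ends : ℕ → ℕ → Set
Ends n m = Fin m → Fin n × Fin n

NoSelfLoops : ∀ {n m} → Ends n m → Set
NoSelfLoops ends = ∀ e → proj₁ (ends e) ≢ proj₂ (ends e)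

data Reach {n m} (ends : Ends n m) (T : Subset m) : Fin n → Fin n → Set where
  here : ∀ {u} → Reach ends T u u
  fwd  : ∀ {u w} e → e ∈ T → proj₁ (ends e) ≡ u →
         Reach ends T (proj₂ (ends e)) w → Reach ends T u w
  bwd  : ∀ {u w} e → e ∈ T → proj₂ (ends e) ≡ u →
         Reach ends T (proj₁ (ends e)) w → Reach ends T u w

Connected : ∀ {n m} → Ends n m → Subset n → Subset m → Set
Connected ends W F = ∀ {u v} → u ∈ W → v ∈ W → Reach ends F u v

Acyclic : ∀ {n m} → Ends n m → Subset m → Set
Acyclic ends T = ∀ {e} → e ∈ T →
  ¬ Reach ends (T ∩ ∁ ⁅ e ⁆) (proj₁ (ends e)) (proj₂ (ends e))

-- T is a spanning tree of the graph (W , F) (edges of F have ends in W).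
record IsSpanningTree {n m} (ends : Ends n m) (W : Subset n) (F T : Subset m) : Set where
  field
    sub  : T ⊆ F
    conn : Connected ends W T
    acyc : Acyclic ends T

Family : ℕ → Set₁
Family m = Subset m → Set

_≐_ : ∀ {m} → Family m → Family m → Set
Γ ≐ Δ = ∀ S → Γ S ⇔ Δ S

Γ[_,_,_] : ∀ {n m} → Ends n m → Subset n → Subset m → Family m
Γ[ ends , W , F ] T = IsSpanningTree ends W F T

ψ : ∀ {m} → Subset m → Family m → Family m
ψ {m} A 𝓕 S = Σ (Subset m) λ γ → 𝓕 γ × S ≡ γ ∩ A

⊕[_]⊕_ : ∀ {m k} → (Fin k → Family m) → Family m → Family m
(⊕[_]⊕_ {m} Γs Γ') S =
  Σ (Fin _ → Subset m) λ γ → Σ (Subset m) λ γ' →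
    (∀ i → Γs i (γ i)) × Γ' γ' × S ≡ ⋃ (List.tabulate γ) ∪ γ'

-- A partition of the vertices, given by a labelling part : Fin n → Fin k,
-- V_i = part⁻¹(i).
module _ {n m k : ℕ} (ends : Ends n m) (part : Fin n → Fin k) where

  Vpart : Fin k → Subset n
  Vpart i = tabulate λ x → ⌊ part x ≟ i ⌋

  Epart : Fin k → Subset m
  Epart i = tabulate λ e → ⌊ part (proj₁ (ends e)) ≟ i ⌋ ∧ ⌊ part (proj₂ (ends e)) ≟ i ⌋

  EP : Subset m
  EP = tabulate λ e → not ⌊ part (proj₁ (ends e)) ≟ part (proj₂ (ends e)) ⌋

  endsP : Ends k m
  endsP e = part (proj₁ (ends e)) , part (proj₂ (ends e))

  record Feasible : Set where
    field
      two≤k : 2 ≤ k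
      onto  : ∀ i → ∃ λ x → part x ≡ i
      conn  : ∀ i → Connected ends (Vpart i) (Epart i)

  ΓGi : Fin k → Family m
  ΓGi i = Γ[ ends , Vpart i , Epart i ]

  ΓGP : Family m
  ΓGP = Γ[ endsP , ⊤ , EP ]

  ΓP : Family m
  ΓP γ = Γ[ ends , ⊤ , ⊤ ] γ × ΓGP (γ ∩ EP)

{-# OPTIONS --safe #-}
-- Every edge lies in exactly one E_i or in E_P, so a spanning tree γ of G is the disjoint
-- union of the pieces γ ∩ E_i and γ ∩ E_P. The key fact: if γ ∩ E_P is acyclic in G_P, then
-- a walk in γ between two vertices of V_i can be rerouted inside E_i, because an excursion
-- out of V_i must return through the edge it left by. Hence γ ∈ Γ^P restricts to spanning
-- trees of the G_i; conversely, spanning trees of the G_i and of G_P glue to a member of Γ^P,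
-- a cycle in the union being impossible in its projection to G_P and, by the key fact, in
-- its restriction to each part. Realising every spanning tree of a G_i or of G_P as such a
-- restriction then only needs spanning trees of the other pieces, which exist since
-- connected graphs have spanning trees (grown by Prim's algorithm).
module Submission where

open import Defs
open import Data.Nat using (ℕ; zero; suc; _≤_; _+_)
import Data.Nat.Properties as ℕ
open import Data.Fin using (Fin; zero; suc; _≟_)
open import Data.Fin.Subset using (Subset; _∈_; _∉_; _⊆_; _∩_; _∪_; ∁; ⁅_⁆; ⋃; ⊤; ⊥; ∣_∣)
open import Data.Fin.Subset.Properties
  using (x∈p∩q⁺; x∈p∩q⁻; x∈p∪q⁺; x∈p∪q⁻; p⊆p∪q; p∩q⊆p; p∩q⊆q; ⊆-antisym; ∈⊤; ∉⊥; _∈?_;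
         x∈⁅x⁆; x∈⁅y⁆⇒x≡y; x≢y⇒x∉⁅y⁆; x∉p⇒x∈∁p; x∈∁p⇒x∉p; p⊂q⇒∣p∣<∣q∣; ∣p∣≤n)
open import Data.Fin.Properties using (any?)
open import Data.Bool using (Bool; T)
open import Data.Bool.Properties using (T-≡; T-∧)
open import Data.Vec using (tabulate)
open import Data.Vec.Properties using ([]=⇒lookup; lookup⇒[]=; lookup∘tabulate)
import Data.List as List
open import Data.Product using (∃; _×_; _,_; proj₁; proj₂)
open import Data.Sum using (_⊎_; inj₁; inj₂)
open import Data.Empty using (⊥-elim)
open import Relation.Nullary using (¬_; Dec; yes; no)
open import Relation.Nullary.Decidable
  using (_×-dec_; _⊎-dec_; ¬?; toWitness; fromWitness; toWitnessFalse; fromWitnessFalse)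
open import Relation.Binary.PropositionalEquality using (_≡_; _≢_; refl; sym; trans; subst)
open import Function.Bundles using (Equivalence; mk⇔)
open import Data.Vec.Functional using (updateAt)
open import Data.Vec.Functional.Properties using (updateAt-updates; updateAt-minimal)

∈-tabulate⁻ : ∀ {n} (f : Fin n → Bool) {x} → x ∈ tabulate f → T (f x)
∈-tabulate⁻ f {x} x∈ = subst T (trans (sym ([]=⇒lookup x∈)) (lookup∘tabulate f x)) _

∈-tabulate⁺ : ∀ {n} (f : Fin n → Bool) {x} → T (f x) → x ∈ tabulate f
∈-tabulate⁺ f {x} t = lookup⇒[]= x (tabulate f) (trans (lookup∘tabulate f x) (Equivalence.to T-≡ t))

∈-⋃⁻ : ∀ {m k} (γ : Fin k → Subset m) {x} → x ∈ ⋃ (List.tabulate γ) → ∃ λ j → x ∈ γ j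
∈-⋃⁻ {k = zero}  γ x∈ = ⊥-elim (∉⊥ x∈)
∈-⋃⁻ {k = suc k} γ x∈ with x∈p∪q⁻ (γ zero) _ x∈
... | inj₁ x∈γ₀ = zero , x∈γ₀
... | inj₂ x∈γₛ with ∈-⋃⁻ (λ j → γ (suc j)) x∈γₛ
...   | j , x∈γⱼ = suc j , x∈γⱼ

∈-⋃⁺ : ∀ {m k} (γ : Fin k → Subset m) {x} j → x ∈ γ j → x ∈ ⋃ (List.tabulate γ)
∈-⋃⁺ γ zero    x∈ = x∈p∪q⁺ (inj₁ x∈)
∈-⋃⁺ γ (suc j) x∈ = x∈p∪q⁺ (inj₂ (∈-⋃⁺ (λ j → γ (suc j)) j x∈))

∈-∖⁺ : ∀ {m} {T : Subset m} {e h} → h ∈ T → h ≢ e → h ∈ T ∩ ∁ ⁅ e ⁆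
∈-∖⁺ h∈ h≢e = x∈p∩q⁺ (h∈ , x∉p⇒x∈∁p (x≢y⇒x∉⁅y⁆ h≢e))

∈-∖⁻ : ∀ {m} {T : Subset m} {e h} → h ∈ T ∩ ∁ ⁅ e ⁆ → h ∈ T × h ≢ e
∈-∖⁻ {T = T} {e} h∈ with x∈p∩q⁻ T (∁ ⁅ e ⁆) h∈
... | h∈T , h∉e = h∈T , λ { refl → x∈∁p⇒x∉p h∉e (x∈⁅x⁆ e) }

infix 4 _⊑_

_⊑_ : ∀ {m} → Family m → Family m → Set
Γ ⊑ Δ = ∀ {S} → Γ S → Δ S

⊑-antisym : ∀ {m} {Γ Δ : Family m} → Γ ⊑ Δ → Δ ⊑ Γ → Γ ≐ Δ
⊑-antisym Γ⊑Δ Δ⊑Γ S = mk⇔ Γ⊑Δ Δ⊑Γ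

⊕-mono : ∀ {m k} {Γs Δs : Fin k → Family m} {Γ Δ : Family m} →
         (∀ i → Γs i ⊑ Δs i) → Γ ⊑ Δ → ⊕[ Γs ]⊕ Γ ⊑ ⊕[ Δs ]⊕ Δ
⊕-mono Γs⊑Δs Γ⊑Δ (γs , γ , γs∈ , γ∈ , S≡) = γs , γ , (λ i → Γs⊑Δs i (γs∈ i)) , Γ⊑Δ γ∈ , S≡

module Walks {n m : ℕ} (ends : Ends n m) where

  Joins : Fin m → Fin n → Fin n → Set
  Joins e a c = (proj₁ (ends e) ≡ a × proj₂ (ends e) ≡ c) ⊎ (proj₂ (ends e) ≡ a × proj₁ (ends e) ≡ c)

  Joins-ends : ∀ e → Joins e (proj₁ (ends e)) (proj₂ (ends e))
  Joins-ends e = inj₁ (refl , refl)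

  Joins-sym : ∀ {e a c} → Joins e a c → Joins e c a
  Joins-sym (inj₁ (p , q)) = inj₂ (q , p)
  Joins-sym (inj₂ (p , q)) = inj₁ (q , p)

  Joins-other : ∀ {e a x c c'} → Joins e a x → Joins e c c' → a ≢ c → c' ≡ a
  Joins-other (inj₁ (refl , refl)) (inj₁ (refl , refl)) a≢c = ⊥-elim (a≢c refl)
  Joins-other (inj₁ (refl , refl)) (inj₂ (refl , refl)) a≢c = refl
  Joins-other (inj₂ (refl , refl)) (inj₁ (refl , refl)) a≢c = refl
  Joins-other (inj₂ (refl , refl)) (inj₂ (refl , refl)) a≢c = ⊥-elim (a≢c refl)

  Joins-either : ∀ {e a x c c'} → Joins e a x → Joins e c c' → a ≡ c ⊎ a ≡ c'
  Joins-either (inj₁ (refl , refl)) (inj₁ (refl , refl)) = inj₁ refl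
  Joins-either (inj₁ (refl , refl)) (inj₂ (refl , refl)) = inj₂ refl
  Joins-either (inj₂ (refl , refl)) (inj₁ (refl , refl)) = inj₂ refl
  Joins-either (inj₂ (refl , refl)) (inj₂ (refl , refl)) = inj₁ refl

  Joins-both⁺ : ∀ (P : Fin n → Set) {e a c} → Joins e a c → P a → P c →
                P (proj₁ (ends e)) × P (proj₂ (ends e))
  Joins-both⁺ P (inj₁ (refl , refl)) pa pc = pa , pc
  Joins-both⁺ P (inj₂ (refl , refl)) pa pc = pc , pa

  Joins-both⁻ : ∀ (P : Fin n → Set) {e a c} → Joins e a c →
                P (proj₁ (ends e)) × P (proj₂ (ends e)) → P a × P c
  Joins-both⁻ P (inj₁ (refl , refl)) (p₁ , p₂) = p₁ , p₂
  Joins-both⁻ P (inj₂ (refl , refl)) (p₁ , p₂) = p₂ , p₁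

  step : ∀ {T e u c w} → e ∈ T → Joins e u c → Reach ends T c w → Reach ends T u w
  step e∈ (inj₁ (eq , refl)) r = fwd _ e∈ eq r
  step e∈ (inj₂ (eq , refl)) r = bwd _ e∈ eq r

  edge : ∀ {T e a c} → e ∈ T → Joins e a c → Reach ends T a c
  edge e∈ j = step e∈ j here

  infixr 5 _++_
  infixl 6 _▷_

  _++_ : ∀ {T a b c} → Reach ends T a b → Reach ends T b c → Reach ends T a c
  here           ++ s = s
  fwd e e∈ eq r  ++ s = fwd e e∈ eq (r ++ s)
  bwd e e∈ eq r  ++ s = bwd e e∈ eq (r ++ s)

  _▷_ : ∀ {T a c c' e} → Reach ends T a c → e ∈ T × Joins e c c' → Reach ends T a c'
  r ▷ (e∈ , j) = r ++ edge e∈ j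

  reverse : ∀ {T a b} → Reach ends T a b → Reach ends T b a
  reverse here             = here
  reverse (fwd e e∈ eq r)  = reverse r ▷ (e∈ , inj₂ (refl , eq))
  reverse (bwd e e∈ eq r)  = reverse r ▷ (e∈ , inj₁ (refl , eq))

  Reach-mono : ∀ {T T' a b} → T ⊆ T' → Reach ends T a b → Reach ends T' a b
  Reach-mono T⊆ here            = here
  Reach-mono T⊆ (fwd e e∈ eq r) = fwd e (T⊆ e∈) eq (Reach-mono T⊆ r)
  Reach-mono T⊆ (bwd e e∈ eq r) = bwd e (T⊆ e∈) eq (Reach-mono T⊆ r)

  Reach-transport : ∀ {T} (P : Fin n → Set) →
                    (∀ {h c c'} → h ∈ T → Joins h c c' → P c → P c') →
                    ∀ {a b} → Reach ends T a b → P a → P b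
  Reach-transport P move here            pa = pa
  Reach-transport P move (fwd e e∈ eq r) pa = Reach-transport P move r (move e∈ (inj₁ (eq , refl)) pa)
  Reach-transport P move (bwd e e∈ eq r) pa = Reach-transport P move r (move e∈ (inj₂ (eq , refl)) pa)

  Reach⇒Reach-ends : ∀ {T e a c} → Joins e a c → Reach ends T a c →
                     Reach ends T (proj₁ (ends e)) (proj₂ (ends e))
  Reach⇒Reach-ends (inj₁ (refl , refl)) r = r
  Reach⇒Reach-ends (inj₂ (refl , refl)) r = reverse r

  Reach-ends⇒Reach : ∀ {T e a c} → Joins e a c →
                     Reach ends T (proj₁ (ends e)) (proj₂ (ends e)) → Reach ends T a c
  Reach-ends⇒Reach (inj₁ (refl , refl)) r = r
  Reach-ends⇒Reach (inj₂ (refl , refl)) r = reverse r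

  connected-from : ∀ {W T} u → (∀ {x} → x ∈ W → Reach ends T u x) → Connected ends W T
  connected-from u reach x∈ y∈ = reverse (reach x∈) ++ reach y∈

  Acyclic-anti : ∀ {T T'} → T' ⊆ T → Acyclic ends T → Acyclic ends T'
  Acyclic-anti {T} {T'} T'⊆T acyclic e∈ r = acyclic (T'⊆T e∈) (Reach-mono shrink r)
    where
    shrink : ∀ {e h} → h ∈ T' ∩ ∁ ⁅ e ⁆ → h ∈ T ∩ ∁ ⁅ e ⁆
    shrink h∈ with ∈-∖⁻ h∈
    ... | h∈T' , h≢e = ∈-∖⁺ (T'⊆T h∈T') h≢e

  module _ {R R' : Subset m} {e x y} (e-joins : Joins e x y) (x≢y : x ≢ y)
           (pendant : ∀ {h c} → h ∈ R → Joins h y c → h ≡ e)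
           (keep : ∀ {h} → h ∈ R → h ≢ e → h ∈ R') where

    -- A walk can only visit the leaf y by crossing e to y and straight back.
    private
      Shortcut : Fin n → Fin n → Set
      Shortcut a c = (c ≢ y × Reach ends R' a c) ⊎ (c ≡ y × Reach ends R' a x)

      shortcut-step : ∀ {a h c c'} → h ∈ R → Joins h c c' → Shortcut a c → Shortcut a c'
      shortcut-step {h = h} {c} {c'} h∈ j (inj₁ (c≢y , r)) with h ≟ e
      ... | yes refl = inj₂ (c'≡y , subst (Reach ends R' _) c≡x r)
        where
        c'≡y : c' ≡ y
        c'≡y = Joins-other (Joins-sym e-joins) j (λ y≡c → c≢y (sym y≡c))
        c≡x : c ≡ x
        c≡x = Joins-other e-joins (Joins-sym j) (λ x≡c' → x≢y (trans x≡c' c'≡y))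
      ... | no h≢e = inj₁ (c'≢y , r ▷ (keep h∈ h≢e , j))
        where
        c'≢y : c' ≢ y
        c'≢y refl = h≢e (pendant h∈ (Joins-sym j))
      shortcut-step h∈ j (inj₂ (refl , r)) with pendant h∈ j
      ... | refl with Joins-other e-joins j x≢y
      ...   | refl = inj₁ (x≢y , r)

    avoid-pendant : ∀ {a b} → Reach ends R a b → a ≢ y → b ≢ y → Reach ends R' a b
    avoid-pendant r a≢y b≢y with Reach-transport (Shortcut _) shortcut-step r (inj₁ (a≢y , here))
    ... | inj₁ (_ , r') = r'
    ... | inj₂ (b≡y , _) = ⊥-elim (b≢y b≡y)

module Prim {n m : ℕ} (ends : Ends n m) (F : Subset m) (root : Fin n) where
  open Walks ends

  record Subtree (S : Subset n) (T : Subset m) : Set where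
    field
      root∈   : root ∈ S
      reach   : ∀ {x} → x ∈ S → Reach ends T root x
      T⊆F     : T ⊆ F
      ends∈   : ∀ {e} → e ∈ T → proj₁ (ends e) ∈ S × proj₂ (ends e) ∈ S
      acyclic : Acyclic ends T

  Subtree-root : Subtree ⁅ root ⁆ ⊥
  Subtree-root = record
    { root∈   = x∈⁅x⁆ root
    ; reach   = λ x∈ → subst (Reach ends ⊥ root) (sym (x∈⁅y⁆⇒x≡y root x∈)) here
    ; T⊆F     = λ e∈ → ⊥-elim (∉⊥ e∈)
    ; ends∈   = λ e∈ → ⊥-elim (∉⊥ e∈)
    ; acyclic = λ e∈ → ⊥-elim (∉⊥ e∈)
    }

  Subtree-extend : ∀ {S T e x y} → Subtree S T → e ∈ F → Joins e x y → x ∈ S → y ∉ S →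
                   Subtree (S ∪ ⁅ y ⁆) (T ∪ ⁅ e ⁆)
  Subtree-extend {S} {T} {e} {x} {y} st e∈F e-joins x∈S y∉S = record
    { root∈   = S⊆ root∈
    ; reach   = reach′
    ; T⊆F     = T⊆F′
    ; ends∈   = ends∈′
    ; acyclic = acyclic′
    }
    where
    open Subtree st

    S⊆ : S ⊆ S ∪ ⁅ y ⁆
    S⊆ = p⊆p∪q _

    T⊆ : T ⊆ T ∪ ⁅ e ⁆
    T⊆ = p⊆p∪q _

    new-edge : ∀ {h} → h ∈ T ∪ ⁅ e ⁆ → h ∈ T ⊎ h ≡ e
    new-edge h∈ with x∈p∪q⁻ T ⁅ e ⁆ h∈
    ... | inj₁ h∈T = inj₁ h∈T
    ... | inj₂ h∈e = inj₂ (x∈⁅y⁆⇒x≡y e h∈e)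

    old-edge : ∀ {h g} → h ∈ (T ∪ ⁅ e ⁆) ∩ ∁ ⁅ g ⁆ → h ≢ e → h ∈ T ∩ ∁ ⁅ g ⁆
    old-edge h∈ h≢e with ∈-∖⁻ h∈
    ... | h∈T∪e , h≢g with new-edge h∈T∪e
    ...   | inj₁ h∈T  = ∈-∖⁺ h∈T h≢g
    ...   | inj₂ h≡e  = ⊥-elim (h≢e h≡e)

    T∪e∖e⊆T : (T ∪ ⁅ e ⁆) ∩ ∁ ⁅ e ⁆ ⊆ T
    T∪e∖e⊆T g∈ = proj₁ (∈-∖⁻ (old-edge g∈ (proj₂ (∈-∖⁻ g∈))))

    ∈S⇒≢y : ∀ {z} → z ∈ S → z ≢ y
    ∈S⇒≢y z∈S refl = y∉S z∈S

    stays-in-S : ∀ {a b} → Reach ends T a b → a ∈ S → b ∈ S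
    stays-in-S = Reach-transport (_∈ S) λ h∈ h-joins _ → proj₂ (Joins-both⁻ (_∈ S) h-joins (ends∈ h∈))

    reach′ : ∀ {z} → z ∈ S ∪ ⁅ y ⁆ → Reach ends (T ∪ ⁅ e ⁆) root z
    reach′ z∈ with x∈p∪q⁻ S ⁅ y ⁆ z∈
    ... | inj₁ z∈S = Reach-mono T⊆ (reach z∈S)
    ... | inj₂ z∈y with x∈⁅y⁆⇒x≡y y z∈y
    ...   | refl = Reach-mono T⊆ (reach x∈S) ▷ (x∈p∪q⁺ (inj₂ (x∈⁅x⁆ e)) , e-joins)

    T⊆F′ : T ∪ ⁅ e ⁆ ⊆ F
    T⊆F′ h∈ with new-edge h∈
    ... | inj₁ h∈T = T⊆F h∈T
    ... | inj₂ refl = e∈F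

    ends∈′ : ∀ {h} → h ∈ T ∪ ⁅ e ⁆ → proj₁ (ends h) ∈ S ∪ ⁅ y ⁆ × proj₂ (ends h) ∈ S ∪ ⁅ y ⁆
    ends∈′ h∈ with new-edge h∈
    ... | inj₁ h∈T  = S⊆ (proj₁ (ends∈ h∈T)) , S⊆ (proj₂ (ends∈ h∈T))
    ... | inj₂ refl = Joins-both⁺ (_∈ S ∪ ⁅ y ⁆) e-joins (S⊆ x∈S) (x∈p∪q⁺ (inj₂ (x∈⁅x⁆ y)))

    acyclic′ : Acyclic ends (T ∪ ⁅ e ⁆)
    acyclic′ {h} h∈ r with new-edge h∈
    ... | inj₂ refl = y∉S (stays-in-S (Reach-ends⇒Reach e-joins (Reach-mono T∪e∖e⊆T r)) x∈S)
    ... | inj₁ h∈T = acyclic h∈T (avoid-pendant e-joins (∈S⇒≢y x∈S) pendant old-edge r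
                                   (∈S⇒≢y (proj₁ (ends∈ h∈T))) (∈S⇒≢y (proj₂ (ends∈ h∈T))))
      where
      pendant : ∀ {g c} → g ∈ (T ∪ ⁅ e ⁆) ∩ ∁ ⁅ h ⁆ → Joins g y c → g ≡ e
      pendant g∈ g-joins with new-edge (proj₁ (∈-∖⁻ g∈))
      ... | inj₁ g∈T = ⊥-elim (y∉S (proj₁ (Joins-both⁻ (_∈ S) g-joins (ends∈ g∈T))))
      ... | inj₂ g≡e = g≡e

  module _ {W : Subset n} (root∈W : root ∈ W) (connected : Connected ends W F) where

    private
      Leaving : Subset n → Fin m → Set
      Leaving S e = e ∈ F × ( proj₁ (ends e) ∈ S × proj₂ (ends e) ∉ S
                            ⊎ proj₂ (ends e) ∈ S × proj₁ (ends e) ∉ S)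

      leaving? : ∀ S → Dec (∃ (Leaving S))
      leaving? S = any? λ e → (e ∈? F) ×-dec
        (  (proj₁ (ends e) ∈? S ×-dec ¬? (proj₂ (ends e) ∈? S))
        ⊎-dec (proj₂ (ends e) ∈? S ×-dec ¬? (proj₁ (ends e) ∈? S)))

      closed : ∀ {S} → ¬ ∃ (Leaving S) → ∀ {h c c'} → h ∈ F → Joins h c c' → c ∈ S → c' ∈ S
      closed {S} none {h} {c' = c'} h∈ h-joins c∈ with c' ∈? S | h-joins
      ... | yes c'∈ | _                    = c'∈
      ... | no  c'∉ | inj₁ (refl , refl) = ⊥-elim (none (h , h∈ , inj₁ (c∈ , c'∉)))
      ... | no  c'∉ | inj₂ (refl , refl) = ⊥-elim (none (h , h∈ , inj₂ (c∈ , c'∉)))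

      ∣S∣<∣S∪y∣ : ∀ {S : Subset n} {y} → y ∉ S → suc ∣ S ∣ ≤ ∣ S ∪ ⁅ y ⁆ ∣
      ∣S∣<∣S∪y∣ {y = y} y∉S = p⊂q⇒∣p∣<∣q∣ (p⊆p∪q _ , y , x∈p∪q⁺ (inj₂ (x∈⁅x⁆ y)) , y∉S)

      grow : ∀ d {S T} → Subtree S T → n ≤ ∣ S ∣ + d → ∃ (IsSpanningTree ends W F)
      grow-along : ∀ d {S T e x y} → Subtree S T → n ≤ ∣ S ∣ + d →
                   e ∈ F → Joins e x y → x ∈ S → y ∉ S → ∃ (IsSpanningTree ends W F)

      grow d {S} {T} st n≤ with leaving? S
      ... | no none = T , record
        { sub  = T⊆F
        ; conn = connected-from root λ v∈W →
                   reach (Reach-transport (_∈ S) (closed none) (connected root∈W v∈W) root∈)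
        ; acyc = acyclic
        }
        where open Subtree st
      ... | yes (e , e∈F , inj₁ (x∈ , y∉)) = grow-along d st n≤ e∈F (Joins-ends e) x∈ y∉
      ... | yes (e , e∈F , inj₂ (y∈ , x∉)) = grow-along d st n≤ e∈F (Joins-sym (Joins-ends e)) y∈ x∉

      grow-along zero {S} {y = y} st n≤ e∈F e-joins x∈ y∉ =
        ⊥-elim (ℕ.<⇒≱ (ℕ.<-≤-trans (∣S∣<∣S∪y∣ y∉) (∣p∣≤n (S ∪ ⁅ y ⁆)))
                      (subst (n ≤_) (ℕ.+-identityʳ _) n≤))
      grow-along (suc d) {S} st n≤ e∈F e-joins x∈ y∉ =
        grow d (Subtree-extend st e∈F e-joins x∈ y∉)
          (ℕ.≤-trans n≤ (ℕ.≤-trans (ℕ.≤-reflexive (ℕ.+-suc ∣ S ∣ d))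
                                   (ℕ.+-monoˡ-≤ d (∣S∣<∣S∪y∣ y∉))))

    spanning-tree : ∃ (IsSpanningTree ends W F)
    spanning-tree = grow n Subtree-root (ℕ.m≤n+m n _)

module Partition {n m k : ℕ} (ends : Ends n m) (part : Fin n → Fin k) where
  open Walks ends
  module Shrunk = Walks (endsP ends part)

  part₁ part₂ : Fin m → Fin k
  part₁ h = part (proj₁ (ends h))
  part₂ h = part (proj₂ (ends h))

  ∈Vpart⁺ : ∀ {x i} → part x ≡ i → x ∈ Vpart ends part i
  ∈Vpart⁺ {x} {i} px≡i = ∈-tabulate⁺ _ (fromWitness {a? = part x ≟ i} px≡i)

  ∈Vpart⁻ : ∀ {x i} → x ∈ Vpart ends part i → part x ≡ i
  ∈Vpart⁻ {x} {i} x∈ = toWitness {a? = part x ≟ i} (∈-tabulate⁻ _ x∈)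

  ∈Epart⁺ : ∀ {h a c i} → Joins h a c → part a ≡ i → part c ≡ i → h ∈ Epart ends part i
  ∈Epart⁺ {h} {i = i} h-joins pa≡i pc≡i with Joins-both⁺ (λ v → part v ≡ i) h-joins pa≡i pc≡i
  ... | p₁≡i , p₂≡i =
    ∈-tabulate⁺ _ (Equivalence.from T-∧ (fromWitness {a? = part₁ h ≟ i} p₁≡i , fromWitness {a? = part₂ h ≟ i} p₂≡i))

  ∈Epart⁻ : ∀ {h i} → h ∈ Epart ends part i → part₁ h ≡ i × part₂ h ≡ i
  ∈Epart⁻ {h} {i} h∈ with Equivalence.to T-∧ (∈-tabulate⁻ _ h∈)
  ... | t₁ , t₂ = toWitness {a? = part₁ h ≟ i} t₁ , toWitness {a? = part₂ h ≟ i} t₂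

  ∈EP⁺ : ∀ {h a c} → Joins h a c → part a ≢ part c → h ∈ EP ends part
  ∈EP⁺ {h} (inj₁ (refl , refl)) pa≢pc =
    ∈-tabulate⁺ _ (fromWitnessFalse {a? = part₁ h ≟ part₂ h} pa≢pc)
  ∈EP⁺ {h} (inj₂ (refl , refl)) pa≢pc =
    ∈-tabulate⁺ _ (fromWitnessFalse {a? = part₁ h ≟ part₂ h} (λ eq → pa≢pc (sym eq)))

  ∈EP⁻ : ∀ {h} → h ∈ EP ends part → part₁ h ≢ part₂ h
  ∈EP⁻ {h} h∈ = toWitnessFalse {a? = part₁ h ≟ part₂ h} (∈-tabulate⁻ _ h∈)

  Epart∩EP-disjoint : ∀ {h i} → h ∈ Epart ends part i → h ∉ EP ends part
  Epart∩EP-disjoint h∈Eᵢ h∈EP with ∈Epart⁻ h∈Eᵢ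
  ... | p₁≡i , p₂≡i = ∈EP⁻ h∈EP (trans p₁≡i (sym p₂≡i))

  Epart-unique : ∀ {h i j} → h ∈ Epart ends part i → h ∈ Epart ends part j → i ≡ j
  Epart-unique h∈Eᵢ h∈Eⱼ = trans (sym (proj₁ (∈Epart⁻ h∈Eᵢ))) (proj₁ (∈Epart⁻ h∈Eⱼ))

  Epart⊎EP : ∀ h → h ∈ Epart ends part (part₁ h) ⊎ h ∈ EP ends part
  Epart⊎EP h with part₁ h ≟ part₂ h
  ... | yes p₁≡p₂ = inj₁ (∈Epart⁺ (Joins-ends h) refl (sym p₁≡p₂))
  ... | no  p₁≢p₂ = inj₂ (∈EP⁺ (Joins-ends h) p₁≢p₂)

  Joins-shrink : ∀ {h a c} → Joins h a c → Shrunk.Joins h (part a) (part c)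
  Joins-shrink (inj₁ (refl , refl)) = inj₁ (refl , refl)
  Joins-shrink (inj₂ (refl , refl)) = inj₂ (refl , refl)

  shrink-step : ∀ {T h c c' p} → (part c ≢ part c' → h ∈ T) → Joins h c c' →
                Reach (endsP ends part) T p (part c) → Reach (endsP ends part) T p (part c')
  shrink-step {c = c} {c'} h∈ h-joins r with part c ≟ part c'
  ... | yes pc≡pc' = subst (Reach (endsP ends part) _ _) pc≡pc' r
  ... | no  pc≢pc' = r Shrunk.▷ (h∈ pc≢pc' , Joins-shrink h-joins)

  project : ∀ {R a b} → Reach ends R a b → Reach (endsP ends part) (R ∩ EP ends part) (part a) (part b)
  project r = Reach-transport (λ c → Reach (endsP ends part) _ (part _) (part c))
                (λ h∈ h-joins → shrink-step (λ ne → x∈p∩q⁺ (h∈ , ∈EP⁺ h-joins ne)) h-joins) r here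

  module _ {R : Subset m} (acyclic : Acyclic (endsP ends part) (R ∩ EP ends part)) (i : Fin k) where

    -- A walk that leaves V_i through an edge f must come back through f: returning
    -- through another edge of E_P would close a cycle through f in the shrunk graph.
    private
      record Excursion (a c : Fin n) : Set where
        field
          exit        : Fin m
          {last first} : Fin n
          exit∈       : exit ∈ R ∩ EP ends part
          exit-joins  : Joins exit last first
          last∈       : part last ≡ i
          inside-walk : Reach ends (R ∩ Epart ends part i) a last
          outside     : part c ≢ i
          shadow      : Reach (endsP ends part) ((R ∩ EP ends part) ∩ ∁ ⁅ exit ⁆) (part first) (part c)

      Progress : Fin n → Fin n → Set
      Progress a c = (part c ≡ i × Reach ends (R ∩ Epart ends part i) a c) ⊎ Excursion a c

      inside-step : ∀ {a h c c'} → h ∈ R → Joins h c c' → part c ≡ i →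
                    Reach ends (R ∩ Epart ends part i) a c → Progress a c'
      inside-step {h = h} {c} {c'} h∈ h-joins pc≡i r with part c' ≟ i
      ... | yes pc'≡i = inj₁ (pc'≡i , r ▷ (x∈p∩q⁺ (h∈ , ∈Epart⁺ h-joins pc≡i pc'≡i) , h-joins))
      ... | no  pc'≢i = inj₂ record
        { exit        = h
        ; exit∈       = x∈p∩q⁺ (h∈ , ∈EP⁺ h-joins λ eq → pc'≢i (trans (sym eq) pc≡i))
        ; exit-joins  = h-joins
        ; last∈       = pc≡i
        ; inside-walk = r
        ; outside     = pc'≢i
        ; shadow      = here
        }

      excursion-step : ∀ {a h c c'} → h ∈ R → Joins h c c' → Excursion a c → Progress a c'
      excursion-step {a} {h} {c} {c'} h∈ h-joins ex = continue (part c' ≟ i) (h ≟ exit)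
        where
        open Excursion ex

        Q : Subset m
        Q = (R ∩ EP ends part) ∩ ∁ ⁅ exit ⁆

        last≢c : last ≢ c
        last≢c refl = outside last∈

        crossing : part c' ≡ i → h ∈ EP ends part
        crossing pc'≡i = ∈EP⁺ h-joins λ eq → outside (trans eq pc'≡i)

        continue : Dec (part c' ≡ i) → Dec (h ≡ exit) → Progress a c'
        continue (yes pc'≡i) (yes refl) with Joins-other exit-joins h-joins last≢c
        ... | refl = inj₁ (pc'≡i , inside-walk)
        continue (yes pc'≡i) (no h≢exit) =
          ⊥-elim (acyclic exit∈ (Shrunk.Reach⇒Reach-ends (Joins-shrink exit-joins) cycle))
          where
          back : Reach (endsP ends part) Q (part c') (part first)
          back = Shrunk.reverse
            (shadow Shrunk.▷ (∈-∖⁺ (x∈p∩q⁺ (h∈ , crossing pc'≡i)) h≢exit , Joins-shrink h-joins))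
          cycle : Reach (endsP ends part) Q (part last) (part first)
          cycle = subst (λ v → Reach (endsP ends part) Q v (part first)) (trans pc'≡i (sym last∈)) back
        continue (no pc'≢i) (yes refl) with Joins-either exit-joins h-joins
        ... | inj₁ last≡c  = ⊥-elim (last≢c last≡c)
        ... | inj₂ refl    = ⊥-elim (pc'≢i last∈)
        continue (no pc'≢i) (no h≢exit) = inj₂ record
          { exit        = exit
          ; exit∈       = exit∈
          ; exit-joins  = exit-joins
          ; last∈       = last∈
          ; inside-walk = inside-walk
          ; outside     = pc'≢i
          ; shadow      = shrink-step (λ ne → ∈-∖⁺ (x∈p∩q⁺ (h∈ , ∈EP⁺ h-joins ne)) h≢exit) h-joins shadow
          }

      progress-step : ∀ {a h c c'} → h ∈ R → Joins h c c' → Progress a c → Progress a c'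
      progress-step h∈ h-joins (inj₁ (pc≡i , r)) = inside-step h∈ h-joins pc≡i r
      progress-step h∈ h-joins (inj₂ ex)         = excursion-step h∈ h-joins ex

    restrict : ∀ {a b} → Reach ends R a b → part a ≡ i → part b ≡ i → Reach ends (R ∩ Epart ends part i) a b
    restrict r pa≡i pb≡i with Reach-transport (Progress _) progress-step r (inj₁ (pa≡i , here))
    ... | inj₁ (_ , r') = r'
    ... | inj₂ ex       = ⊥-elim (Excursion.outside ex pb≡i)

  lift : ∀ {S t : Subset m} → t ⊆ S → (∀ {x y} → part x ≡ part y → Reach ends S x y) →
         ∀ {x y} → Reach (endsP ends part) t (part x) (part y) → Reach ends S x y
  lift {S} {t} t⊆S within {x} r = Shrunk.Reach-transport Lifts lift-step r (λ py≡px → within (sym py≡px)) refl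
    where
    Lifts : Fin k → Set
    Lifts p = ∀ {y} → part y ≡ p → Reach ends S x y

    lift-step : ∀ {h p p'} → h ∈ t → Shrunk.Joins h p p' → Lifts p → Lifts p'
    lift-step {h} h∈ (inj₁ (p₁≡p , p₂≡p')) reach py≡p' =
      reach p₁≡p ▷ (t⊆S h∈ , Joins-ends h) ++ within (trans p₂≡p' (sym py≡p'))
    lift-step {h} h∈ (inj₂ (p₂≡p , p₁≡p')) reach py≡p' =
      reach p₂≡p ▷ (t⊆S h∈ , Joins-sym (Joins-ends h)) ++ within (trans p₁≡p' (sym py≡p'))

  shrunk-connected : Connected ends ⊤ ⊤ → (∀ i → ∃ λ x → part x ≡ i) →
                     Connected (endsP ends part) ⊤ (EP ends part)
  shrunk-connected connected onto {p} {q} _ _ with onto p | onto q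
  ... | x , refl | y , refl = Shrunk.Reach-mono (p∩q⊆q ⊤ _) (project (connected {x} {y} ∈⊤ ∈⊤))

  restrict-spanning : ∀ {γ} → ΓP ends part γ → ∀ i → ΓGi ends part i (γ ∩ Epart ends part i)
  restrict-spanning {γ} (γ-tree , γP-tree) i = record
    { sub  = p∩q⊆q γ _
    ; conn = λ u∈ v∈ → restrict (IsSpanningTree.acyc γP-tree) i (IsSpanningTree.conn γ-tree ∈⊤ ∈⊤)
                                (∈Vpart⁻ u∈) (∈Vpart⁻ v∈)
    ; acyc = Acyclic-anti (p∩q⊆p γ _) (IsSpanningTree.acyc γ-tree)
    }

  decompose : ∀ γ → γ ≡ ⋃ (List.tabulate (λ i → γ ∩ Epart ends part i)) ∪ (γ ∩ EP ends part)
  decompose γ = ⊆-antisym into back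
    where
    pieces : Fin k → Subset m
    pieces i = γ ∩ Epart ends part i

    into : γ ⊆ ⋃ (List.tabulate pieces) ∪ (γ ∩ EP ends part)
    into {h} h∈ with Epart⊎EP h
    ... | inj₁ h∈Eᵢ = x∈p∪q⁺ (inj₁ (∈-⋃⁺ pieces _ (x∈p∩q⁺ (h∈ , h∈Eᵢ))))
    ... | inj₂ h∈EP = x∈p∪q⁺ (inj₂ (x∈p∩q⁺ (h∈ , h∈EP)))

    back : ⋃ (List.tabulate pieces) ∪ (γ ∩ EP ends part) ⊆ γ
    back h∈ with x∈p∪q⁻ (⋃ (List.tabulate pieces)) _ h∈
    ... | inj₂ h∈γ∩EP = p∩q⊆p γ _ h∈γ∩EP
    ... | inj₁ h∈⋃ with ∈-⋃⁻ pieces h∈⋃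
    ...   | i , h∈γ∩Eᵢ = p∩q⊆p γ _ h∈γ∩Eᵢ

  module Union (ts : Fin k → Subset m) (t : Subset m)
               (ts-tree : ∀ i → ΓGi ends part i (ts i)) (t-tree : ΓGP ends part t) where

    γ : Subset m
    γ = ⋃ (List.tabulate ts) ∪ t

    private
      split : ∀ {h} → h ∈ γ → (∃ λ j → h ∈ ts j) ⊎ h ∈ t
      split h∈ with x∈p∪q⁻ (⋃ (List.tabulate ts)) t h∈
      ... | inj₁ h∈⋃ = inj₁ (∈-⋃⁻ ts h∈⋃)
      ... | inj₂ h∈t = inj₂ h∈t

      ts⊆γ : ∀ j → ts j ⊆ γ
      ts⊆γ j h∈ = x∈p∪q⁺ (inj₁ (∈-⋃⁺ ts j h∈))

      t⊆γ : t ⊆ γ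
      t⊆γ h∈ = x∈p∪q⁺ (inj₂ h∈)

      ts⊆Epart : ∀ {j h} → h ∈ ts j → h ∈ Epart ends part j
      ts⊆Epart {j} = IsSpanningTree.sub (ts-tree j)

      t⊆EP : t ⊆ EP ends part
      t⊆EP = IsSpanningTree.sub t-tree

      ∖-∩-⊆ : ∀ {A B C : Subset m} {e} → A ∩ B ⊆ C → (A ∩ ∁ ⁅ e ⁆) ∩ B ⊆ C ∩ ∁ ⁅ e ⁆
      ∖-∩-⊆ {B = B} A∩B⊆C h∈ with x∈p∩q⁻ _ B h∈
      ... | h∈A∖e , h∈B with ∈-∖⁻ h∈A∖e
      ...   | h∈A , h≢e = ∈-∖⁺ (A∩B⊆C (x∈p∩q⁺ (h∈A , h∈B))) h≢e

    γ∩EP⊆t : γ ∩ EP ends part ⊆ t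
    γ∩EP⊆t h∈ with x∈p∩q⁻ γ _ h∈
    ... | h∈γ , h∈EP with split h∈γ
    ...   | inj₁ (j , h∈tsⱼ) = ⊥-elim (Epart∩EP-disjoint (ts⊆Epart h∈tsⱼ) h∈EP)
    ...   | inj₂ h∈t         = h∈t

    γ∩Epart⊆ts : ∀ i → γ ∩ Epart ends part i ⊆ ts i
    γ∩Epart⊆ts i {h} h∈ with x∈p∩q⁻ γ _ h∈
    ... | h∈γ , h∈Eᵢ with split h∈γ
    ...   | inj₁ (j , h∈tsⱼ) = subst (λ j → h ∈ ts j) (Epart-unique (ts⊆Epart h∈tsⱼ) h∈Eᵢ) h∈tsⱼ
    ...   | inj₂ h∈t         = ⊥-elim (Epart∩EP-disjoint h∈Eᵢ (t⊆EP h∈t))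

    γ∩EP≡t : γ ∩ EP ends part ≡ t
    γ∩EP≡t = ⊆-antisym γ∩EP⊆t λ h∈ → x∈p∩q⁺ (t⊆γ h∈ , t⊆EP h∈)

    γ∩Epart≡ts : ∀ i → γ ∩ Epart ends part i ≡ ts i
    γ∩Epart≡ts i = ⊆-antisym (γ∩Epart⊆ts i) λ h∈ → x∈p∩q⁺ (ts⊆γ i h∈ , ts⊆Epart h∈)

    γ∖e-shrunk-acyclic : ∀ e → Acyclic (endsP ends part) ((γ ∩ ∁ ⁅ e ⁆) ∩ EP ends part)
    γ∖e-shrunk-acyclic e =
      Shrunk.Acyclic-anti (λ h∈ → proj₁ (∈-∖⁻ (∖-∩-⊆ γ∩EP⊆t h∈))) (IsSpanningTree.acyc t-tree)

    γ-acyclic : Acyclic ends γ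
    γ-acyclic {e} e∈ r with split e∈
    ... | inj₂ e∈t = IsSpanningTree.acyc t-tree e∈t (Shrunk.Reach-mono (∖-∩-⊆ γ∩EP⊆t) (project r))
    ... | inj₁ (j , e∈tsⱼ) with ∈Epart⁻ (ts⊆Epart e∈tsⱼ)
    ...   | p₁≡j , p₂≡j = IsSpanningTree.acyc (ts-tree j) e∈tsⱼ
      (Reach-mono (∖-∩-⊆ (γ∩Epart⊆ts j)) (restrict (γ∖e-shrunk-acyclic e) j r p₁≡j p₂≡j))

    γ-connected : Connected ends ⊤ γ
    γ-connected _ _ = lift t⊆γ within (IsSpanningTree.conn t-tree ∈⊤ ∈⊤)
      where
      within : ∀ {x y} → part x ≡ part y → Reach ends γ x y
      within {y = y} px≡py =
        Reach-mono (ts⊆γ (part y)) (IsSpanningTree.conn (ts-tree (part y)) (∈Vpart⁺ px≡py) (∈Vpart⁺ refl))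

    γ∈ΓP : ΓP ends part γ
    γ∈ΓP = record { sub = λ _ → ∈⊤ ; conn = γ-connected ; acyc = γ-acyclic }
         , subst (ΓGP ends part) (sym γ∩EP≡t) t-tree

  ψ-EP-ΓP⊑ΓGP : ψ (EP ends part) (ΓP ends part) ⊑ ΓGP ends part
  ψ-EP-ΓP⊑ΓGP (γ , (_ , γ∩EP-tree) , refl) = γ∩EP-tree

  ψ-Epart-ΓP⊑ΓGi : ∀ i → ψ (Epart ends part i) (ΓP ends part) ⊑ ΓGi ends part i
  ψ-Epart-ΓP⊑ΓGi i (γ , γ∈ , refl) = restrict-spanning γ∈ i

  ⊕-ΓGi-ΓGP⊑ΓP : ⊕[ ΓGi ends part ]⊕ ΓGP ends part ⊑ ΓP ends part
  ⊕-ΓGi-ΓGP⊑ΓP (ts , t , ts-tree , t-tree , refl) = Union.γ∈ΓP ts t ts-tree t-tree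

  ΓP⊑⊕-ψ : ΓP ends part ⊑ ⊕[ (λ i → ψ (Epart ends part i) (ΓP ends part)) ]⊕ ψ (EP ends part) (ΓP ends part)
  ΓP⊑⊕-ψ {γ} γ∈ = (λ i → γ ∩ Epart ends part i) , γ ∩ EP ends part
                 , (λ i → γ , γ∈ , refl) , (γ , γ∈ , refl) , decompose γ

  module _ (part-tree : ∀ i → ∃ (ΓGi ends part i)) where

    ΓGP⊑ψ-EP-ΓP : ΓGP ends part ⊑ ψ (EP ends part) (ΓP ends part)
    ΓGP⊑ψ-EP-ΓP {t} t-tree = Union.γ ts t ts-tree t-tree , Union.γ∈ΓP ts t ts-tree t-tree
                            , sym (Union.γ∩EP≡t ts t ts-tree t-tree)
      where
      ts : Fin k → Subset m
      ts i = proj₁ (part-tree i)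
      ts-tree : ∀ i → ΓGi ends part i (ts i)
      ts-tree i = proj₂ (part-tree i)

    ΓGi⊑ψ-Epart-ΓP : ∃ (ΓGP ends part) → ∀ i → ΓGi ends part i ⊑ ψ (Epart ends part i) (ΓP ends part)
    ΓGi⊑ψ-Epart-ΓP (t , t-tree) i {S} S-tree =
      Union.γ ts t ts-tree t-tree , Union.γ∈ΓP ts t ts-tree t-tree
      , trans (sym (updateAt-updates i _)) (sym (Union.γ∩Epart≡ts ts t ts-tree t-tree i))
      where
      ts : Fin k → Subset m
      ts = updateAt (λ j → proj₁ (part-tree j)) i λ _ → S
      ts-tree : ∀ j → ΓGi ends part j (ts j)
      ts-tree j with j ≟ i
      ... | yes refl = subst (ΓGi ends part j) (sym (updateAt-updates j _)) S-tree
      ... | no  j≢i  = subst (ΓGi ends part j) (sym (updateAt-minimal j i _ j≢i)) (proj₂ (part-tree j))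

mainTheorem4 : ∀ {n m k : ℕ} (ends : Ends n m) → NoSelfLoops ends →
    Connected ends ⊤ ⊤ →
    (part : Fin n → Fin k) → Feasible ends part →
    (ψ (EP ends part) (ΓP ends part) ≐ ΓGP ends part)
    × (∀ i → ψ (Epart ends part i) (ΓP ends part) ≐ ΓGi ends part i)
    × (ΓP ends part ≐ (⊕[ (λ i → ψ (Epart ends part i) (ΓP ends part)) ]⊕ ψ (EP ends part) (ΓP ends part)))
    × (ΓP ends part ≐ (⊕[ ΓGi ends part ]⊕ ΓGP ends part))
mainTheorem4 ends _ connected part feasible =
    ⊑-antisym ψ-EP-ΓP⊑ΓGP (ΓGP⊑ψ-EP-ΓP part-tree)
  , (λ i → ⊑-antisym (ψ-Epart-ΓP⊑ΓGi i) (ΓGi⊑ψ-Epart-ΓP part-tree (shrunk-tree i) i))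
  , ⊑-antisym ΓP⊑⊕-ψ (λ S∈ → ⊕-ΓGi-ΓGP⊑ΓP (⊕ψ⊑⊕Γ S∈))
  , ⊑-antisym (λ S∈ → ⊕ψ⊑⊕Γ (ΓP⊑⊕-ψ S∈)) ⊕-ΓGi-ΓGP⊑ΓP
  where
  open Partition ends part
  open Feasible feasible

  part-tree : ∀ i → ∃ (ΓGi ends part i)
  part-tree i =
    Prim.spanning-tree ends (Epart ends part i) (proj₁ (onto i)) (∈Vpart⁺ (proj₂ (onto i))) (conn i)

  shrunk-tree : Fin _ → ∃ (ΓGP ends part)
  shrunk-tree root =
    Prim.spanning-tree (endsP ends part) (EP ends part) root ∈⊤ (shrunk-connected connected onto)

  ⊕ψ⊑⊕Γ : ⊕[ (λ i → ψ (Epart ends part i) (ΓP ends part)) ]⊕ ψ (EP ends part) (ΓP ends part)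
          ⊑ ⊕[ ΓGi ends part ]⊕ ΓGP ends part
  ⊕ψ⊑⊕Γ = ⊕-mono ψ-Epart-ΓP⊑ΓGi ψ-EP-ΓP⊑ΓGP
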